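{- Let $(\mathbb{V},\star,R)$ be a modal $\mathbb{K}$-algebra, and for $X\subseteq V$ let $\Diamond X:=R^{ -1}[X]=\{v\mid\exists u\,(vRu\text{ and }u\in X)\}$. Then for all $X\subseteq V$, $\Diamond[X]\subseteq[\Diamond X]$.
   Context: A $\mathbb{K}$-algebra is a vector space $\mathbb{V}$ over a field $\mathbb{K}$ with a bilinear map $\star$. A modal $\mathbb{K}$-algebra is $(\mathbb{V},\star,R)$ with $R\subseteq V\times V$ such that: (L1R) if $vRu$ and $zRw$ then for all $\gamma,\delta\in\mathbb{K}$ there are $\alpha,\beta\in\mathbb{K}$ with $(\gamma v+\delta z)R(\alpha u+\beta w)$; (L2R) if $tR(\alpha u+\beta v)$ then there exist $\lambda,\mu\in\mathbb{K}$ and $z,w\in V$ with $zRu$, $wRv$, $\lambda z+\mu w=t$; (L3R) $xR0$ iff $x=0$. $[X]$ denotes the linear span of $X$, with $[\emptyset]=\{0\}$. -}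

module Defs where

open import Level using (Level; _⊔_; suc)
open import Algebra.Bundles using (CommutativeRing)
open import Algebra.Module.Bundles using (Module)
open import Data.Product using (Σ; ∃; _×_; _,_; proj₂)
open import Data.List using (List; []; _∷_)
open import Data.List.Relation.Unary.All using (All)
open import Relation.Nullary using (¬_)

record IsField {c ℓ : Level} (K : CommutativeRing c ℓ) : Set (c ⊔ ℓ) where
  open CommutativeRing K
  field
    1≉0 : ¬ (1# ≈ 0#)
    inverse : ∀ x → ¬ (x ≈ 0#) → Σ Carrier λ y → (x * y) ≈ 1#

record VectorSpace (c ℓ m ℓm : Level) : Set (suc (c ⊔ ℓ ⊔ m ⊔ ℓm)) where
  field
    K       : CommutativeRing c ℓ
    isField : IsField K
    V       : Module K m ℓm
  open CommutativeRing K public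
  open Module V public

record IsBilinear {c ℓ m ℓm} (𝕍 : VectorSpace c ℓ m ℓm)
                  (_⋆_ : VectorSpace.Carrierᴹ 𝕍 → VectorSpace.Carrierᴹ 𝕍 → VectorSpace.Carrierᴹ 𝕍)
                  : Set (c ⊔ m ⊔ ℓm) where
  open VectorSpace 𝕍
  field
    ⋆-cong : ∀ {x x′ y y′} → x ≈ᴹ x′ → y ≈ᴹ y′ → (x ⋆ y) ≈ᴹ (x′ ⋆ y′)
    linearˡ : ∀ (α β : Carrier) x y z →
              ((α *ₗ x +ᴹ β *ₗ y) ⋆ z) ≈ᴹ (α *ₗ (x ⋆ z) +ᴹ β *ₗ (y ⋆ z))
    linearʳ : ∀ (α β : Carrier) x y z →
              (z ⋆ (α *ₗ x +ᴹ β *ₗ y)) ≈ᴹ (α *ₗ (z ⋆ x) +ᴹ β *ₗ (z ⋆ y))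

-- A modal K-algebra (V, ⋆, R). Since vectors are compared up to the
-- setoid equality ≈ᴹ, R is required to respect ≈ᴹ.
record ModalAlgebra (c ℓ m ℓm r : Level) : Set (suc (c ⊔ ℓ ⊔ m ⊔ ℓm ⊔ r)) where
  field
    𝕍 : VectorSpace c ℓ m ℓm
  open VectorSpace 𝕍 public
  field
    _⋆_ : Carrierᴹ → Carrierᴹ → Carrierᴹ
    ⋆-bilinear : IsBilinear 𝕍 _⋆_
    R : Carrierᴹ → Carrierᴹ → Set r
    R-resp : ∀ {v v′ u u′} → v ≈ᴹ v′ → u ≈ᴹ u′ → R v u → R v′ u′
    L1R : ∀ {v u z w} → R v u → R z w → ∀ (γ δ : Carrier) →
          Σ Carrier λ α → Σ Carrier λ β → R (γ *ₗ v +ᴹ δ *ₗ z) (α *ₗ u +ᴹ β *ₗ w)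
    L2R : ∀ {t u v} (α β : Carrier) → R t (α *ₗ u +ᴹ β *ₗ v) →
          Σ Carrier λ λ′ → Σ Carrier λ μ → Σ Carrierᴹ λ z → Σ Carrierᴹ λ w →
            R z u × R w v × ((λ′ *ₗ z +ᴹ μ *ₗ w) ≈ᴹ t)
    L3R : ∀ x → (R x 0ᴹ → x ≈ᴹ 0ᴹ) × (x ≈ᴹ 0ᴹ → R x 0ᴹ)

module _ {c ℓ m ℓm r : Level} (𝔸 : ModalAlgebra c ℓ m ℓm r) where
  open ModalAlgebra 𝔸

  Subset : (p : Level) → Set (m ⊔ suc p)
  Subset p = Carrierᴹ → Set p

  _⊆_ : ∀ {p q} → Subset p → Subset q → Set (m ⊔ p ⊔ q)
  X ⊆ Y = ∀ v → X v → Y v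

  lincomb : List (Carrier × Carrierᴹ) → Carrierᴹ
  lincomb [] = 0ᴹ
  lincomb ((α , x) ∷ l) = α *ₗ x +ᴹ lincomb l

  Span : ∀ {p} → Subset p → Subset (c ⊔ m ⊔ ℓm ⊔ p)
  Span X v = Σ (List (Carrier × Carrierᴹ)) λ l →
               All (λ e → X (proj₂ e)) l × (v ≈ᴹ lincomb l)

  ◇ : ∀ {p} → Subset p → Subset (m ⊔ r ⊔ p)
  ◇ X v = Σ Carrierᴹ λ u → R v u × X u

module Submission where

open import Defs
open import Level using (Level)
open import Data.Product using (_,_; proj₁; proj₂; map₁)
open import Data.List using (List; []; _∷_; map)
open import Data.List.Relation.Unary.All using (All; []; _∷_)
open import Data.List.Relation.Unary.All.Properties using (map⁺)

-- By induction on a linear combination u = Σ αᵢ xᵢ: axiom L2R splits an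
-- R-predecessor of α x + u′ into a combination of an R-predecessor of x and
-- one of u′, and L3R makes every R-predecessor of the empty combination 0.

module _ {c ℓ m ℓm r : Level} (𝔸 : ModalAlgebra c ℓ m ℓm r) where
  open ModalAlgebra 𝔸

  lincomb-*ₗ : ∀ μ l → μ *ₗ lincomb 𝔸 l ≈ᴹ lincomb 𝔸 (map (map₁ (μ *_)) l)
  lincomb-*ₗ μ [] = *ₗ-zeroʳ μ
  lincomb-*ₗ μ ((α , x) ∷ l) =
    ≈ᴹ-trans (*ₗ-distribˡ μ (α *ₗ x) (lincomb 𝔸 l))
             (+ᴹ-cong (≈ᴹ-sym (*ₗ-assoc μ α x)) (lincomb-*ₗ μ l))

  module _ {p : Level} {Y : Subset 𝔸 p} where

    Span-resp : ∀ {v v′} → v ≈ᴹ v′ → Span 𝔸 Y v → Span 𝔸 Y v′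
    Span-resp v≈v′ (l , Yl , v≈l) = l , Yl , ≈ᴹ-trans (≈ᴹ-sym v≈v′) v≈l

    Span-*ₗ : ∀ μ {v} → Span 𝔸 Y v → Span 𝔸 Y (μ *ₗ v)
    Span-*ₗ μ (l , Yl , v≈l) =
      map (map₁ (μ *_)) l , map⁺ Yl , ≈ᴹ-trans (*ₗ-congˡ v≈l) (lincomb-*ₗ μ l)

    Span-+ᴹ-*ₗ : ∀ α {z w} → Y z → Span 𝔸 Y w → Span 𝔸 Y (α *ₗ z +ᴹ w)
    Span-+ᴹ-*ₗ α {z} Yz (l , Yl , w≈l) =
      (α , z) ∷ l , Yz ∷ Yl , +ᴹ-congˡ w≈l

  R-lincomb⇒Span◇ : ∀ {p} {X : Subset 𝔸 p} l → All (λ e → X (proj₂ e)) l →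
                    ∀ {t} → R t (lincomb 𝔸 l) → Span 𝔸 (◇ 𝔸 X) t
  R-lincomb⇒Span◇ [] [] {t} tR0 = [] , [] , proj₁ (L3R t) tR0
  R-lincomb⇒Span◇ ((α , x) ∷ l) (Xx ∷ Xl) tR
    with L2R α 1# (R-resp ≈ᴹ-refl (+ᴹ-congˡ (≈ᴹ-sym (*ₗ-identityˡ _))) tR)
  ... | λ′ , μ , z , w , zRx , wRl , λ′z+μw≈t =
    Span-resp λ′z+μw≈t
      (Span-+ᴹ-*ₗ λ′ (x , zRx , Xx) (Span-*ₗ μ (R-lincomb⇒Span◇ l Xl wRl)))

mainTheorem9 : ∀ {c ℓ m ℓm r p : Level} (𝔸 : ModalAlgebra c ℓ m ℓm r)
                 (X : Subset 𝔸 p) →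
                 _⊆_ 𝔸 (◇ 𝔸 (Span 𝔸 X)) (Span 𝔸 (◇ 𝔸 X))
mainTheorem9 𝔸 X v (u , vRu , l , Xl , u≈l) =
  R-lincomb⇒Span◇ 𝔸 l Xl (R-resp ≈ᴹ-refl u≈l vRu)
  where open ModalAlgebra 𝔸
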